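{- A triangulation $\Gamma$ of a connected closed $2$-dimensional surface is $z$-knotted if and only if for every face $F$ of $\Gamma$ the $z$-monodromy $M_F$ is one of the following: (M1) the identity; (M2) $D_F$; (M3) $(-e_1,e_2,e_3)(-e_3,-e_2,e_1)$ where $(e_1,e_2,e_3)$ is one of the cycles of $D_F$; (M4) $(e_1,-e_2)(e_2,-e_1)$ where $(e_1,e_2,e_3)$ is one of the cycles of $D_F$ (with $e_3,-e_3$ fixed).
   Context: Let $\Gamma$ be a connected simple finite graph embedded in a connected closed $2$-dimensional surface such that every face (closure of a component of the complement) is a closed $2$-disc, every edge lies in exactly two distinct faces, two distinct faces meet in an edge, a vertex, or not at all, and every face has exactly three edges (a triangulation). Two distinct edges are adjacent if they share a vertex and lie in a common face. A zigzag is a sequence of edges $(e_i)_{i\in\mathbb N}$ with $e_i,e_{i+1}$ adjacent and the face containing $e_i,e_{i+1}$ distinct from the face containing $e_{i+1},e_{i+2}$, for all $i$; it is periodic and regarded as a cyclic sequence; written as a cyclic sequence of vertices, each passage through an edge has a direction (an oriented edge). A zigzag is determined by any two consecutive oriented edges; its reverse $Z^{ -1}$ is also a zigzag. $\Gamma$ is $z$-knotted if it has exactly one pair of zigzags $\{Z,Z^{ -1}\}$. For a face $F$ with vertices $a,b,c$, let $\Omega(F)=\{ab,bc,ca,ac,cb,ba\}$ be its oriented edges, $-e$ the reverse of $e$, and $D_F=(ab,bc,ca)(ac,cb,ba)$ (so $D_F(xy)=yz$ for distinct $x,y,z$). The $z$-monodromy $M_F:\Omega(F)\to\Omega(F)$: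 for $e\in\Omega(F)$ take $e_0$ with $D_F(e_0)=e$ and the zigzag $Z$ containing consecutive oriented edges $e_0,e$; $M_F(e)$ is the first element of $\Omega(F)$ occurring in $Z$ after $e$. -}

module Defs where

open import Data.Nat using (ℕ; _≤_; _<_)
open import Data.Integer as ℤ using (ℤ; +_; _-_)
open import Data.Fin using (Fin)
open import Data.Bool using (Bool; true)
open import Data.Product using (Σ; Σ-syntax; ∃; ∃-syntax; _×_; _,_)
open import Data.Sum using (_⊎_)
open import Data.List using (List; []; _∷_)
open import Data.List.Relation.Unary.Any using (Any)
open import Data.List.Relation.Unary.All using (All)
open import Relation.Binary.PropositionalEquality using (_≡_; _≢_)
open import Relation.Binary.Construct.Closure.ReflexiveTransitive using (Star)
open import Relation.Nullary using (¬_)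

-- Vertices are Fin n; a face is determined by its (unordered) vertex
-- triple, encoded by a symmetric Boolean predicate `face x y z`.
-- (Simplicity of Γ and "two distinct faces meet in an edge, a vertex or
-- not at all" mean that a face is determined by its three vertices.)

record Triangulation (n : ℕ) : Set where
  field
    face      : Fin n → Fin n → Fin n → Bool
    face-swap : ∀ x y z → face x y z ≡ face y x z
    face-rot  : ∀ x y z → face x y z ≡ face y z x
    face-distinct : ∀ x y z → face x y z ≡ true → x ≢ y × y ≢ z × x ≢ z
    some-face : ∃[ x ] ∃[ y ] ∃[ z ] face x y z ≡ true
    vertex-on-face : ∀ v → ∃[ y ] ∃[ z ] face v y z ≡ true
    edge-two-faces : ∀ x y z → face x y z ≡ true →
      Σ[ w ∈ Fin n ] (w ≢ z × face x y w ≡ true ×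
        (∀ u → face x y u ≡ true → u ≡ z ⊎ u ≡ w))
    -- closed surface: the link of every vertex is connected (a single cycle)
    link-connected : ∀ v y z y′ z′ → face v y z ≡ true → face v y′ z′ ≡ true →
      Star (λ a b → face v a b ≡ true) y y′
    connected : ∀ x y → Star (λ a b → ∃[ c ] face a b c ≡ true) x y

module _ {n : ℕ} (T : Triangulation n) where
  open Triangulation T

  OEdge : Set
  OEdge = Fin n × Fin n

  -- A zigzag, written as a (bi-infinite, hence cyclic since periodic)
  -- sequence of vertices  … v₀ v₁ v₂ …  ; the i-th oriented edge is
  -- vᵢ → vᵢ₊₁.  Consecutive edges vᵢvᵢ₊₁, vᵢ₊₁vᵢ₊₂ lie in the face
  -- {vᵢ,vᵢ₊₁,vᵢ₊₂}; consecutive such faces are distinct (vᵢ₊₃ ≢ vᵢ).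
  record Zigzag : Set where
    field
      seq    : ℤ → Fin n
      inFace : ∀ i → face (seq i) (seq (ℤ.suc i)) (seq (ℤ.suc (ℤ.suc i))) ≡ true
      turn   : ∀ i → seq (ℤ.suc (ℤ.suc (ℤ.suc i))) ≢ seq i
  open Zigzag public

  SameZigzag : Zigzag → Zigzag → Set
  SameZigzag Z Z′ = ∃[ k ] ∀ i → seq Z′ i ≡ seq Z (i ℤ.+ k)

  ReverseZigzag : Zigzag → Zigzag → Set
  ReverseZigzag Z Z′ = ∃[ k ] ∀ i → seq Z′ i ≡ seq Z (k - i)

  -- exactly one pair {Z, Z⁻¹} of zigzags
  ZKnotted : Set
  ZKnotted = ∃[ Z ] ∀ Z′ → SameZigzag Z Z′ ⊎ ReverseZigzag Z Z′

  InΩ : Fin n → Fin n → Fin n → OEdge → Set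
  InΩ a b c (u , v) = (u ≡ a ⊎ u ≡ b ⊎ u ≡ c) × (v ≡ a ⊎ v ≡ b ⊎ v ≡ c) × u ≢ v

  -- z-monodromy relation:  M_F (y→z) ≡ e′ , where F = {x,y,z},
  -- e₀ = x→y (so D_F e₀ = y→z) and Z is the zigzag containing x→y, y→z.
  Monodromy : Fin n → Fin n → Fin n → OEdge → Set
  Monodromy x y z e′ =
    Σ[ Z ∈ Zigzag ] Σ[ i ∈ ℤ ]
      (seq Z i ≡ x × seq Z (i ℤ.+ + 1) ≡ y × seq Z (i ℤ.+ + 2) ≡ z ×
       Σ[ j ∈ ℕ ] (1 ≤ j ×
         (seq Z (i ℤ.+ + 1 ℤ.+ + j) , seq Z (i ℤ.+ + 2 ℤ.+ + j)) ≡ e′ ×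
         InΩ x y z e′ ×
         (∀ k → 1 ≤ k → k < j →
           ¬ InΩ x y z (seq Z (i ℤ.+ + 1 ℤ.+ + k) , seq Z (i ℤ.+ + 2 ℤ.+ + k)))))

  -- M_F agrees with a permutation of Ω(F) given by its graph
  -- (a list of pairs (e , π e) covering Ω(F)).
  -- M_F(u→v) is computed with e₀ = w→u where w is the third vertex.
  MonoIs : List ((Fin n × Fin n × Fin n) × OEdge) → Set
  MonoIs graph = All (λ { ((w , u , v) , e′) → Monodromy w u v e′ }) graph

  -- For the ordering (x,y,z) of F: the six oriented edges, labelled by
  -- the D_F-predecessor triple (w,u,v) meaning edge u→v.
  -- ab = (c,a,b) etc.
  module _ (x y z : Fin n) where
    xy yz zx xz zy yx : Fin n × Fin n × Fin n
    xy = (z , x , y)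
    yz = (x , y , z)
    zx = (y , z , x)
    xz = (y , x , z)
    zy = (x , z , y)
    yx = (z , y , x)

    oe : Fin n × Fin n × Fin n → OEdge
    oe (_ , u , v) = (u , v)

    M1 : Set
    M1 = MonoIs
      ((xy , oe xy) ∷ (yz , oe yz) ∷ (zx , oe zx) ∷
       (xz , oe xz) ∷ (zy , oe zy) ∷ (yx , oe yx) ∷ [])

    -- (M2) D_F = (xy,yz,zx)(xz,zy,yx)
    M2 : Set
    M2 = MonoIs
      ((xy , oe yz) ∷ (yz , oe zx) ∷ (zx , oe xy) ∷
       (xz , oe zy) ∷ (zy , oe yx) ∷ (yx , oe xz) ∷ [])

    -- (M3) with e₁ = xy, e₂ = yz, e₃ = zx :
    --   (-e₁, e₂, e₃)(-e₃, -e₂, e₁) = (yx, yz, zx)(xz, zy, xy)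
    M3 : Set
    M3 = MonoIs
      ((yx , oe yz) ∷ (yz , oe zx) ∷ (zx , oe yx) ∷
       (xz , oe zy) ∷ (zy , oe xy) ∷ (xy , oe xz) ∷ [])

    -- (M4) with e₁ = xy, e₂ = yz, e₃ = zx :
    --   (e₁, -e₂)(e₂, -e₁) = (xy, zy)(yz, yx), zx and xz fixed
    M4 : Set
    M4 = MonoIs
      ((xy , oe zy) ∷ (zy , oe xy) ∷ (yz , oe yx) ∷
       (yx , oe yz) ∷ (zx , oe zx) ∷ (xz , oe xz) ∷ [])

  -- the six orderings (x,y,z) of the face {a,b,c}; the choice of ordering
  -- corresponds to choosing a cycle (e₁,e₂,e₃) = (xy,yz,zx) of D_F
  -- together with its starting element e₁.
  orderings : Fin n → Fin n → Fin n → List (Fin n × Fin n × Fin n)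
  orderings a b c =
    (a , b , c) ∷ (b , c , a) ∷ (c , a , b) ∷
    (a , c , b) ∷ (c , b , a) ∷ (b , a , c) ∷ []

  AdmissibleMonodromy : Fin n → Fin n → Fin n → Set
  AdmissibleMonodromy a b c =
    M1 a b c ⊎ M2 a b c ⊎
    Any (λ { (x , y , z) → M3 x y z }) (orderings a b c) ⊎
    Any (λ { (x , y , z) → M4 x y z }) (orderings a b c)

-- A zigzag is determined by any corner x → y → z it passes (Determinism),
-- so zigzags sharing a corner are shifts of each other, no zigzag is its own
-- reverse, and every corner of a face lies on a zigzag.  For a face F the six
-- ways to pass through F are passages (apex, orientation); M_F is read off
-- from consecutive passages of a zigzag through F (module OnFace).
-- (⇐, Converse) Call a corner good if a fixed Z₀ or its reverse passes it.
-- Every admissible M_F contains a circulation A → B → C → A of passages, so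
-- one good corner makes the whole face good; goodness crosses edges, goes
-- around vertex links and along paths, so every zigzag is Z₀ or Z₀⁻¹.
-- (⇒, Knotted) The unique zigzag Z is periodic, passes every apex of F in
-- exactly one orientation, and its three successive passages through F (at
-- distinct apexes) give the six values of M_F; the sixteen order/orientation
-- patterns are exactly the admissible monodromies (assemble).
module Submission where

open import Defs
open import Data.Nat as ℕ using (ℕ; zero; suc; z≤n; s≤s)
import Data.Nat.Properties as ℕP
open import Data.Integer as ℤ using (ℤ; +_; -[1+_]; 1ℤ; 0ℤ)
import Data.Integer.Properties as ℤP
import Data.Integer.DivMod as ℤDM
open import Data.Integer.Tactic.RingSolver using (solve-∀)
open import Data.Fin as Fin using (Fin)
import Data.Fin.Properties as FinP
open import Data.Bool using (Bool; true; false; not)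
open import Data.List using (List; []; _∷_)
open import Data.List.Relation.Unary.All using ([]; _∷_)
open import Data.List.Relation.Unary.Any using (Any; here; there; any?; satisfied)
open import Data.List.Membership.Propositional using (_∈_; lose)
open import Data.Product using (Σ; ∃; _×_; _,_; proj₁; proj₂)
open import Data.Sum using (_⊎_; inj₁; inj₂; [_,_]′)
open import Data.Empty using (⊥; ⊥-elim)
open import Relation.Nullary using (¬_; Dec; yes; no)
open import Relation.Nullary.Decidable using (_×-dec_)
open import Relation.Binary.PropositionalEquality
open import Relation.Binary.Definitions using (tri<; tri≈; tri>)
open import Relation.Binary.Construct.Closure.ReflexiveTransitive using (Star; ε; _◅_)
open import Function.Bundles using (_⇔_; mk⇔)

module LeastWitness {P : ℕ → Set} (P? : ∀ k → Dec (P k)) where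
  Least : ℕ → Set
  Least m = P m × (∀ k → k ℕ.< m → ¬ P k)

  search : ∀ N → (∀ k → k ℕ.< N → ¬ P k) ⊎ Σ ℕ Least
  search zero = inj₁ (λ k ())
  search (suc N) with search N
  ... | inj₂ found = inj₂ found
  ... | inj₁ none with P? N
  ...   | yes p = inj₂ (N , p , none)
  ...   | no ¬p = inj₁ λ k k<1+N →
           [ none k , (λ { refl → ¬p }) ]′ (ℕP.m≤n⇒m<n∨m≡n (ℕ.s≤s⁻¹ k<1+N))

  least : ∀ N → P N → Σ ℕ Least
  least N p with search N
  ... | inj₂ found = found
  ... | inj₁ none = N , p , none

-- Arithmetic of time indices (routine ring normalisation; ℤ.suc t is
-- 1ℤ ℤ.+ t by definition, which is the form the ring solver reads).
minus-plus : ∀ s i → (s ℤ.- i) ℤ.+ i ≡ s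
minus-plus = solve-∀

plus-1 : ∀ i → i ℤ.+ + 1 ≡ 1ℤ ℤ.+ i
plus-1 = solve-∀

plus-2 : ∀ i → i ℤ.+ + 2 ≡ 1ℤ ℤ.+ (1ℤ ℤ.+ i)
plus-2 = solve-∀

plus-1-plus : ∀ i j → (i ℤ.+ + 1) ℤ.+ j ≡ 1ℤ ℤ.+ (i ℤ.+ j)
plus-1-plus = solve-∀

plus-2-plus : ∀ i j → (i ℤ.+ + 2) ℤ.+ j ≡ 1ℤ ℤ.+ (1ℤ ℤ.+ (i ℤ.+ j))
plus-2-plus = solve-∀

plus-2-plus′ : ∀ i j → (i ℤ.+ + 2) ℤ.+ j ≡ 1ℤ ℤ.+ (i ℤ.+ (+ 1 ℤ.+ j))
plus-2-plus′ = solve-∀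

suc-inside : ∀ i j → 1ℤ ℤ.+ (i ℤ.+ j) ≡ i ℤ.+ (+ 1 ℤ.+ j)
suc-inside = solve-∀

-- The three vertices of a face are named by their position A, B, C,
-- cyclically ordered A → B → C → A.
data Apex : Set where
  A B C : Apex

succ pred : Apex → Apex
succ A = B
succ B = C
succ C = A
pred A = C
pred B = A
pred C = B

around : ∀ m m′ → m′ ≡ pred m ⊎ m′ ≡ m ⊎ m′ ≡ succ m
around A A = inj₂ (inj₁ refl)
around A B = inj₂ (inj₂ refl)
around A C = inj₁ refl
around B A = inj₁ refl
around B B = inj₂ (inj₁ refl)
around B C = inj₂ (inj₂ refl)
around C A = inj₂ (inj₂ refl)
around C B = inj₁ refl
around C C = inj₂ (inj₁ refl)

succ≢self : ∀ m → succ m ≢ m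
succ≢self A ()
succ≢self B ()
succ≢self C ()

pred≢self : ∀ m → pred m ≢ m
pred≢self A ()
pred≢self B ()
pred≢self C ()

pred≢succ : ∀ m → pred m ≢ succ m
pred≢succ A ()
pred≢succ B ()
pred≢succ C ()

third-apex : ∀ m m₁ → m₁ ≢ m → Σ Apex λ m₂ → m₂ ≢ m × m₂ ≢ m₁
third-apex m m₁ d with around m m₁
... | inj₁ refl = succ m , succ≢self m , (λ e → pred≢succ m (sym e))
... | inj₂ (inj₁ refl) = ⊥-elim (d refl)
... | inj₂ (inj₂ refl) = pred m , pred≢self m , pred≢succ m

returns-to-A : ∀ m₁ m₂ m₃ → m₁ ≢ A → m₂ ≢ m₁ → m₂ ≢ A → m₃ ≢ m₂ → m₃ ≢ m₁ → m₃ ≡ A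
returns-to-A _ _ A _ _ _ _ _ = refl
returns-to-A A _ _ d _ _ _ _ = ⊥-elim (d refl)
returns-to-A _ A _ _ _ d _ _ = ⊥-elim (d refl)
returns-to-A B B _ _ d _ _ _ = ⊥-elim (d refl)
returns-to-A C C _ _ d _ _ _ = ⊥-elim (d refl)
returns-to-A B C B _ _ _ _ d = ⊥-elim (d refl)
returns-to-A B C C _ _ _ d _ = ⊥-elim (d refl)
returns-to-A C B B _ _ _ d _ = ⊥-elim (d refl)
returns-to-A C B C _ _ _ _ d = ⊥-elim (d refl)

-- A passage of a zigzag through a face: the apex at which it turns and its
-- orientation; (m , true) runs pred m → m → succ m, (m , false) backwards.
Passage : Set
Passage = Apex × Bool

apex : Passage → Apex
apex = proj₁

before after : Passage → Apex
before (m , true) = pred m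
before (m , false) = succ m
after (m , true) = succ m
after (m , false) = pred m

flip : Passage → Passage
flip (m , o) = m , not o

-- advance π starts with the last two vertices of π, retreat π ends with its first two
advance retreat : Passage → Passage
advance π = after π , proj₂ π
retreat π = before π , proj₂ π

advance-corner : ∀ π → before (advance π) ≡ apex π × after (advance π) ≡ before π
advance-corner (A , true) = refl , refl
advance-corner (A , false) = refl , refl
advance-corner (B , true) = refl , refl
advance-corner (B , false) = refl , refl
advance-corner (C , true) = refl , refl
advance-corner (C , false) = refl , refl

retreat-corner : ∀ π → before (retreat π) ≡ after π × after (retreat π) ≡ apex π
retreat-corner (A , true) = refl , refl
retreat-corner (A , false) = refl , refl
retreat-corner (B , true) = refl , refl
retreat-corner (B , false) = refl , refl
retreat-corner (C , true) = refl , refl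
retreat-corner (C , false) = refl , refl

around-passage : ∀ π m → m ≡ before π ⊎ m ≡ apex π ⊎ m ≡ after π
around-passage (m₀ , true) m = around m₀ m
around-passage (m₀ , false) m =
  [ (λ e → inj₂ (inj₂ e)) , [ (λ e → inj₂ (inj₁ e)) , inj₁ ]′ ]′ (around m₀ m)

passage-≡ : ∀ {π π′} → apex π ≡ apex π′ → before π ≡ before π′ → π ≡ π′
passage-≡ {m , true} {.m , true} refl _ = refl
passage-≡ {m , true} {.m , false} refl e = ⊥-elim (pred≢succ m e)
passage-≡ {m , false} {.m , true} refl e = ⊥-elim (pred≢succ m (sym e))
passage-≡ {m , false} {.m , false} refl _ = refl

same-apex : ∀ π π′ → apex π′ ≡ apex π → π′ ≡ π ⊎ π′ ≡ flip π
same-apex (m , true) (.m , true) refl = inj₁ refl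
same-apex (m , true) (.m , false) refl = inj₂ refl
same-apex (m , false) (.m , true) refl = inj₂ refl
same-apex (m , false) (.m , false) refl = inj₁ refl

-- the six passages, listed to decide whether a zigzag passes a corner of a face
all-passages : List Passage
all-passages = (A , true) ∷ (A , false) ∷ (B , true) ∷ (B , false) ∷ (C , true) ∷ (C , false) ∷ []

listed : ∀ π → π ∈ all-passages
listed (A , true) = here refl
listed (A , false) = there (here refl)
listed (B , true) = there (there (here refl))
listed (B , false) = there (there (there (here refl)))
listed (C , true) = there (there (there (there (here refl))))
listed (C , false) = there (there (there (there (there (here refl)))))

module Zigzags {n : ℕ} (T : Triangulation n) where
  open Triangulation T

  V : Set
  V = Fin n

  Face : V → V → V → Set
  Face x y z = face x y z ≡ true

  rotate : ∀ {x y z} → Face x y z → Face y z x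
  rotate {x} {y} {z} f = trans (sym (face-rot x y z)) f

  swap : ∀ {x y z} → Face x y z → Face y x z
  swap {x} {y} {z} f = trans (sym (face-swap x y z)) f

  mirror : ∀ {x y z} → Face x y z → Face z y x
  mirror f = swap (rotate f)

  other-face-unique : ∀ {a b c u v} → Face a b c → Face a b u → Face a b v →
                      u ≢ c → v ≢ c → u ≡ v
  other-face-unique {a} {b} {c} {u} {v} f fu fv u≢c v≢c with edge-two-faces a b c f
  ... | _ , _ , _ , only with only u fu | only v fv
  ... | inj₁ u≡c | _ = ⊥-elim (u≢c u≡c)
  ... | _ | inj₁ v≡c = ⊥-elim (v≢c v≡c)
  ... | inj₂ u≡w | inj₂ v≡w = trans u≡w (sym v≡w)

  shift : Zigzag T → ℤ → Zigzag T
  shift Z k = record { seq = λ t → seq Z (t ℤ.+ k) ; inFace = in-face ; turn = turns }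
    where
    out : ∀ t → ℤ.suc t ℤ.+ k ≡ ℤ.suc (t ℤ.+ k)
    out t = ℤP.+-assoc 1ℤ t k
    out² : ∀ t → ℤ.suc (ℤ.suc t) ℤ.+ k ≡ ℤ.suc (ℤ.suc (t ℤ.+ k))
    out² t = trans (out (ℤ.suc t)) (cong ℤ.suc (out t))
    in-face : ∀ t → Face (seq Z (t ℤ.+ k)) (seq Z (ℤ.suc t ℤ.+ k)) (seq Z (ℤ.suc (ℤ.suc t) ℤ.+ k))
    in-face t = subst₂ (λ p q → Face (seq Z (t ℤ.+ k)) (seq Z p) (seq Z q))
                       (sym (out t)) (sym (out² t)) (inFace Z (t ℤ.+ k))
    turns : ∀ t → seq Z (ℤ.suc (ℤ.suc (ℤ.suc t)) ℤ.+ k) ≢ seq Z (t ℤ.+ k)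
    turns t e = turn Z (t ℤ.+ k)
      (trans (cong (seq Z) (sym (trans (out (ℤ.suc (ℤ.suc t))) (cong ℤ.suc (out² t))))) e)

  reverse : Zigzag T → Zigzag T
  reverse Z = record { seq = λ t → seq Z (ℤ.- t) ; inFace = in-face ; turn = turns }
    where
    r₁ : ∀ t → 1ℤ ℤ.+ (ℤ.- (1ℤ ℤ.+ (1ℤ ℤ.+ t))) ≡ ℤ.- (1ℤ ℤ.+ t)
    r₁ = solve-∀
    r₂ : ∀ t → 1ℤ ℤ.+ (1ℤ ℤ.+ (ℤ.- (1ℤ ℤ.+ (1ℤ ℤ.+ t)))) ≡ ℤ.- t
    r₂ = solve-∀
    r₃ : ∀ t → 1ℤ ℤ.+ (1ℤ ℤ.+ (1ℤ ℤ.+ (ℤ.- (1ℤ ℤ.+ (1ℤ ℤ.+ (1ℤ ℤ.+ t)))))) ≡ ℤ.- t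
    r₃ = solve-∀
    in-face : ∀ t → Face (seq Z (ℤ.- t)) (seq Z (ℤ.- ℤ.suc t)) (seq Z (ℤ.- ℤ.suc (ℤ.suc t)))
    in-face t = mirror (subst₂ (λ p q → Face (seq Z (ℤ.- ℤ.suc (ℤ.suc t))) (seq Z p) (seq Z q))
                               (r₁ t) (r₂ t) (inFace Z (ℤ.- ℤ.suc (ℤ.suc t))))
    turns : ∀ t → seq Z (ℤ.- ℤ.suc (ℤ.suc (ℤ.suc t))) ≢ seq Z (ℤ.- t)
    turns t e = turn Z (ℤ.- ℤ.suc (ℤ.suc (ℤ.suc t))) (trans (cong (seq Z) (r₃ t)) (sym e))

  At : Zigzag T → ℤ → V → V → V → Set
  At W i x y z = seq W i ≡ x × seq W (ℤ.suc i) ≡ y × seq W (ℤ.suc (ℤ.suc i)) ≡ z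

  Traverses : Zigzag T → V → V → V → Set
  Traverses W x y z = ∃ λ i → At W i x y z

  -- A zigzag is determined by three consecutive vertices: the next vertex
  -- completes the last two to the face other than the current one.
  module Determinism (Z W : Zigzag T) where
    Agree3 : ℤ → Set
    Agree3 t = seq Z t ≡ seq W t × seq Z (ℤ.suc t) ≡ seq W (ℤ.suc t) ×
               seq Z (ℤ.suc (ℤ.suc t)) ≡ seq W (ℤ.suc (ℤ.suc t))

    forward : ∀ t → Agree3 t → Agree3 (ℤ.suc t)
    forward t (e₀ , e₁ , e₂) =
      e₁ , e₂ , other-face-unique (rotate (inFace Z t)) (inFace Z (ℤ.suc t)) face-W (turn Z t) turn-W
      where
      face-W : Face (seq Z (ℤ.suc t)) (seq Z (ℤ.suc (ℤ.suc t))) (seq W (ℤ.suc (ℤ.suc (ℤ.suc t))))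
      face-W = subst₂ (λ p q → Face p q _) (sym e₁) (sym e₂) (inFace W (ℤ.suc t))
      turn-W : seq W (ℤ.suc (ℤ.suc (ℤ.suc t))) ≢ seq Z t
      turn-W e = turn W t (trans e e₀)

    backward : ∀ t → Agree3 (ℤ.suc t) → Agree3 t
    backward t (e₁ , e₂ , e₃) =
      other-face-unique (inFace Z (ℤ.suc t)) (rotate (inFace Z t)) face-W (λ e → turn Z t (sym e)) turn-W ,
      e₁ , e₂
      where
      face-W : Face (seq Z (ℤ.suc t)) (seq Z (ℤ.suc (ℤ.suc t))) (seq W t)
      face-W = subst₂ (λ p q → Face p q (seq W t)) (sym e₁) (sym e₂) (rotate (inFace W t))
      turn-W : seq W t ≢ seq Z (ℤ.suc (ℤ.suc (ℤ.suc t)))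
      turn-W e = turn W t (sym (trans e e₃))

    agree : Agree3 0ℤ → ∀ t → seq Z t ≡ seq W t
    agree a (+ m) = proj₁ (upward m)
      where
      upward : ∀ m → Agree3 (+ m)
      upward zero = a
      upward (suc m) = forward (+ m) (upward m)
    agree a -[1+ m ] = proj₁ (downward m)
      where
      downward : ∀ m → Agree3 -[1+ m ]
      downward zero = backward -[1+ 0 ] a
      downward (suc m) = backward -[1+ suc m ] (downward m)

  agree-at : ∀ W Z i k {x y z} → At W i x y z → At Z k x y z →
             ∀ t → seq W (t ℤ.+ i) ≡ seq Z (t ℤ.+ k)
  agree-at W Z i k h h′ =
    Determinism.agree (shift W i) (shift Z k) (common (shift W i) (shift Z k) (origin W i h) (origin Z k h′))
    where
    origin : ∀ U j {x y z} → At U j x y z → At (shift U j) 0ℤ x y z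
    origin U j (e₀ , e₁ , e₂) = trans (cong (seq U) (ℤP.+-identityˡ j)) e₀ , e₁ ,
                                trans (cong (seq U) (ℤP.+-assoc 1ℤ 1ℤ j)) e₂
    common : ∀ U U′ {x y z} → At U 0ℤ x y z → At U′ 0ℤ x y z → Determinism.Agree3 U U′ 0ℤ
    common _ _ (e₀ , e₁ , e₂) (f₀ , f₁ , f₂) = trans e₀ (sym f₀) , trans e₁ (sym f₁) , trans e₂ (sym f₂)

  transfer : ∀ W Z i k m {x y z u v w} → At W i x y z → At Z k x y z → At W m u v w →
             At Z (m ℤ.- i ℤ.+ k) u v w
  transfer W Z i k m h h′ (e₀ , e₁ , e₂) =
    moved m e₀ ,
    trans (cong (seq Z) (sym (suc-out m))) (moved (ℤ.suc m) e₁) ,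
    trans (cong (seq Z) (sym (trans (suc-out (ℤ.suc m)) (cong ℤ.suc (suc-out m))))) (moved (ℤ.suc (ℤ.suc m)) e₂)
    where
    suc-out′ : ∀ s i k → (1ℤ ℤ.+ s) ℤ.- i ℤ.+ k ≡ 1ℤ ℤ.+ (s ℤ.- i ℤ.+ k)
    suc-out′ = solve-∀
    suc-out : ∀ s → ℤ.suc s ℤ.- i ℤ.+ k ≡ ℤ.suc (s ℤ.- i ℤ.+ k)
    suc-out s = suc-out′ s i k
    moved : ∀ s {p} → seq W s ≡ p → seq Z (s ℤ.- i ℤ.+ k) ≡ p
    moved s e = trans (sym (agree-at W Z i k h h′ (s ℤ.- i))) (trans (cong (seq W) (minus-plus s i)) e)

  reverse-at : ∀ W i {x y z} → At W i x y z → At (reverse W) (ℤ.- ℤ.suc (ℤ.suc i)) z y x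
  reverse-at W i (e₀ , e₁ , e₂) =
    trans (cong (seq W) (ℤP.neg-involutive _)) e₂ , trans (cong (seq W) (r₁ i)) e₁ , trans (cong (seq W) (r₂ i)) e₀
    where
    r₁ : ∀ i → ℤ.- (1ℤ ℤ.+ (ℤ.- (1ℤ ℤ.+ (1ℤ ℤ.+ i)))) ≡ 1ℤ ℤ.+ i
    r₁ = solve-∀
    r₂ : ∀ i → ℤ.- (1ℤ ℤ.+ (1ℤ ℤ.+ (ℤ.- (1ℤ ℤ.+ (1ℤ ℤ.+ i))))) ≡ i
    r₂ = solve-∀

  reverse-at⁻ : ∀ W i {x y z} → At (reverse W) i x y z → At W (ℤ.- ℤ.suc (ℤ.suc i)) z y x
  reverse-at⁻ W i (e₀ , e₁ , e₂) = e₂ , trans (cong (seq W) (r₁ i)) e₁ , trans (cong (seq W) (r₂ i)) e₀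
    where
    r₁ : ∀ t → 1ℤ ℤ.+ (ℤ.- (1ℤ ℤ.+ (1ℤ ℤ.+ t))) ≡ ℤ.- (1ℤ ℤ.+ t)
    r₁ = solve-∀
    r₂ : ∀ t → 1ℤ ℤ.+ (1ℤ ℤ.+ (ℤ.- (1ℤ ℤ.+ (1ℤ ℤ.+ t)))) ≡ ℤ.- t
    r₂ = solve-∀

  parity : ∀ c → Σ ℤ λ q → c ≡ q ℤ.+ q ⊎ c ≡ 1ℤ ℤ.+ (q ℤ.+ q)
  parity (+ m) = parity-ℕ m
    where
    parity-ℕ : ∀ m → Σ ℤ λ q → + m ≡ q ℤ.+ q ⊎ + m ≡ 1ℤ ℤ.+ (q ℤ.+ q)
    parity-ℕ zero = 0ℤ , inj₁ refl
    parity-ℕ (suc m) with parity-ℕ m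
    ... | q , inj₁ e = q , inj₂ (cong ℤ.suc e)
    ... | q , inj₂ e = 1ℤ ℤ.+ q , inj₁ (trans (cong ℤ.suc e) (regroup q))
      where
      regroup : ∀ q → 1ℤ ℤ.+ (1ℤ ℤ.+ (q ℤ.+ q)) ≡ (1ℤ ℤ.+ q) ℤ.+ (1ℤ ℤ.+ q)
      regroup = solve-∀
  parity -[1+ m ] with parity (+ m)
  ... | q , inj₁ e = ℤ.- (1ℤ ℤ.+ q) , inj₂ (trans (cong (λ x → ℤ.- (1ℤ ℤ.+ x)) e) (regroup q))
    where
    regroup : ∀ q → ℤ.- (1ℤ ℤ.+ (q ℤ.+ q)) ≡ 1ℤ ℤ.+ ((ℤ.- (1ℤ ℤ.+ q)) ℤ.+ (ℤ.- (1ℤ ℤ.+ q)))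
    regroup = solve-∀
  ... | q , inj₂ e = ℤ.- (1ℤ ℤ.+ q) , inj₁ (trans (cong (λ x → ℤ.- (1ℤ ℤ.+ x)) e) (regroup q))
    where
    regroup : ∀ q → ℤ.- (1ℤ ℤ.+ (1ℤ ℤ.+ (q ℤ.+ q))) ≡ (ℤ.- (1ℤ ℤ.+ q)) ℤ.+ (ℤ.- (1ℤ ℤ.+ q))
    regroup = solve-∀

  -- no zigzag is a palindrome: around its centre it would revisit a vertex
  -- after one or two steps, contradicting distinctness of face vertices
  no-palindrome : ∀ (W : Zigzag T) c → (∀ s → seq W s ≡ seq W (c ℤ.- s)) → ⊥
  no-palindrome W c sym-W with parity c
  ... | q , inj₁ even = proj₂ (proj₂ (face-distinct _ _ _ (inFace W (q ℤ.- 1ℤ))))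
         (trans (sym-W (q ℤ.- 1ℤ)) (cong (seq W) (trans (cong (ℤ._- (q ℤ.- 1ℤ)) even) (mirror-even q))))
    where
    mirror-even : ∀ q → (q ℤ.+ q) ℤ.- (q ℤ.- 1ℤ) ≡ 1ℤ ℤ.+ (1ℤ ℤ.+ (q ℤ.- 1ℤ))
    mirror-even = solve-∀
  ... | q , inj₂ odd = proj₁ (face-distinct _ _ _ (inFace W q))
         (trans (sym-W q) (cong (seq W) (trans (cong (ℤ._- q) odd) (mirror-odd q))))
    where
    mirror-odd : ∀ q → (1ℤ ℤ.+ (q ℤ.+ q)) ℤ.- q ≡ 1ℤ ℤ.+ q
    mirror-odd = solve-∀

  not-both-directions : ∀ W i k {x y z} → At W i x y z → At W k z y x → ⊥
  not-both-directions W i k h h′ = no-palindrome W (i ℤ.+ ℤ.suc (ℤ.suc k)) λ s →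
    trans (cong (seq W) (sym (minus-plus s i)))
      (trans (agree-at W (reverse W) i (ℤ.- ℤ.suc (ℤ.suc k)) h (reverse-at W k h′) (s ℤ.- i))
             (cong (seq W) (reflect s i (ℤ.suc (ℤ.suc k)))))
    where
    reflect : ∀ s i K → ℤ.- ((s ℤ.- i) ℤ.+ ℤ.- K) ≡ (i ℤ.+ K) ℤ.- s
    reflect = solve-∀

  -- A turn: a corner (x, y, z) of a face.  Every turn lies on a zigzag,
  -- obtained by repeatedly crossing to the other face on the last edge
  -- (forwards) or on the first edge (backwards).
  Turn : Set
  Turn = Σ (V × V × V) λ p → Face (proj₁ p) (proj₁ (proj₂ p)) (proj₂ (proj₂ p))

  first second third : Turn → V
  first d = proj₁ (proj₁ d)
  second d = proj₁ (proj₂ (proj₁ d))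
  third d = proj₂ (proj₂ (proj₁ d))

  turn-face : (d : Turn) → Face (first d) (second d) (third d)
  turn-face = proj₂

  ahead : (d : Turn) → Σ V λ w → w ≢ first d × Face (second d) (third d) w ×
          (∀ u → Face (second d) (third d) u → u ≡ first d ⊎ u ≡ w)
  ahead d = edge-two-faces (second d) (third d) (first d) (rotate (turn-face d))

  behind : (d : Turn) → Σ V λ w → w ≢ third d × Face (first d) (second d) w ×
           (∀ u → Face (first d) (second d) u → u ≡ third d ⊎ u ≡ w)
  behind d = edge-two-faces (first d) (second d) (third d) (turn-face d)

  next-turn prev-turn : Turn → Turn
  next-turn d = (second d , third d , proj₁ (ahead d)) , proj₁ (proj₂ (proj₂ (ahead d)))
  prev-turn d = (proj₁ (behind d) , first d , second d) ,
                rotate (rotate (proj₁ (proj₂ (proj₂ (behind d)))))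

  zigzag-through : Turn → Zigzag T
  zigzag-through d = record { seq = s ; inFace = in-face ; turn = turns }
    where
    forwards : ℕ → Turn
    forwards zero = d
    forwards (suc m) = next-turn (forwards m)
    backwards : ℕ → Turn
    backwards zero = prev-turn d
    backwards (suc m) = prev-turn (backwards m)
    s : ℤ → V
    s (+ m) = first (forwards m)
    s -[1+ m ] = first (backwards m)
    in-face : ∀ i → Face (s i) (s (ℤ.suc i)) (s (ℤ.suc (ℤ.suc i)))
    in-face (+ m) = turn-face (forwards m)
    in-face -[1+ 0 ] = turn-face (backwards 0)
    in-face -[1+ 1 ] = turn-face (backwards 1)
    in-face -[1+ suc (suc m) ] = turn-face (backwards (suc (suc m)))
    turns : ∀ i → s (ℤ.suc (ℤ.suc (ℤ.suc i))) ≢ s i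
    turns (+ m) = proj₁ (proj₂ (ahead (forwards m)))
    turns -[1+ 0 ] e = proj₁ (proj₂ (behind d)) (sym e)
    turns -[1+ 1 ] e = proj₁ (proj₂ (behind (backwards 0))) (sym e)
    turns -[1+ 2 ] e = proj₁ (proj₂ (behind (backwards 1))) (sym e)
    turns -[1+ suc (suc (suc m)) ] e = proj₁ (proj₂ (behind (backwards (suc (suc m))))) (sym e)

  zigzag-through-at : ∀ {x y z} (f : Face x y z) → At (zigzag-through ((x , y , z) , f)) 0ℤ x y z
  zigzag-through-at f = refl , refl , refl

  module FaceCorners (a b c : V) where
    vtx : Apex → V
    vtx A = a
    vtx B = b
    vtx C = c

    l1 l2 l3 : Passage → V
    l1 π = vtx (before π)
    l2 π = vtx (apex π)
    l3 π = vtx (after π)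

    AtP : Zigzag T → ℤ → Passage → Set
    AtP W t π = At W t (l1 π) (l2 π) (l3 π)

    -- M_F maps the second edge of the passage π to the first edge of π′
    Mo : Passage → Passage → Set
    Mo π π′ = Monodromy T (l1 π) (l2 π) (l3 π) (l1 π′ , l2 π′)

    mirror-at : ∀ W t π → At W t (l3 π) (l2 π) (l1 π) → AtP W t (flip π)
    mirror-at W t (m , true) h = h
    mirror-at W t (m , false) h = h

    mirror-at⁻ : ∀ W t π → AtP W t (flip π) → At W t (l3 π) (l2 π) (l1 π)
    mirror-at⁻ W t (m , true) h = h
    mirror-at⁻ W t (m , false) h = h

  In3 : V → V → V → V → Set
  In3 x y z u = u ≡ x ⊎ u ≡ y ⊎ u ≡ z

  module OnFace (a b c : V) (fabc : Face a b c) where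
    open FaceCorners a b c

    a≢b : a ≢ b
    a≢b = proj₁ (face-distinct a b c fabc)
    b≢c : b ≢ c
    b≢c = proj₁ (proj₂ (face-distinct a b c fabc))
    a≢c : a ≢ c
    a≢c = proj₂ (proj₂ (face-distinct a b c fabc))

    vtx-injective : ∀ {m m′} → vtx m ≡ vtx m′ → m ≡ m′
    vtx-injective {A} {A} _ = refl
    vtx-injective {A} {B} e = ⊥-elim (a≢b e)
    vtx-injective {A} {C} e = ⊥-elim (a≢c e)
    vtx-injective {B} {A} e = ⊥-elim (a≢b (sym e))
    vtx-injective {B} {B} _ = refl
    vtx-injective {B} {C} e = ⊥-elim (b≢c e)
    vtx-injective {C} {A} e = ⊥-elim (a≢c (sym e))
    vtx-injective {C} {B} e = ⊥-elim (b≢c (sym e))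
    vtx-injective {C} {C} _ = refl

    forward-face : ∀ m → Face (l1 (m , true)) (l2 (m , true)) (l3 (m , true))
    forward-face A = rotate (rotate fabc)
    forward-face B = fabc
    forward-face C = rotate fabc

    passage-face : ∀ π → Face (l1 π) (l2 π) (l3 π)
    passage-face (m , true) = forward-face m
    passage-face (m , false) = mirror (forward-face m)

    passage-injective : ∀ π π′ → l1 π ≡ l1 π′ → l2 π ≡ l2 π′ → π ≡ π′
    passage-injective π π′ e₁ e₂ = passage-≡ (vtx-injective e₂) (vtx-injective e₁)

    l1≢l2 : ∀ π → l1 π ≢ l2 π
    l1≢l2 (m , true) e = pred≢self m (vtx-injective e)
    l1≢l2 (m , false) e = succ≢self m (vtx-injective e)

    same-time : ∀ W t π π′ → AtP W t π → AtP W t π′ → π ≡ π′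
    same-time W t π π′ (e₀ , e₁ , _) (f₀ , f₁ , _) = passage-injective π π′ (trans (sym e₀) f₀) (trans (sym e₁) f₁)

    OnF : V → Set
    OnF u = Σ Apex λ m → vtx m ≡ u

    on-passage : ∀ π {u} → OnF u → In3 (l1 π) (l2 π) (l3 π) u
    on-passage π (m , refl) =
      [ (λ e → inj₁ (cong vtx e)) , [ (λ e → inj₂ (inj₁ (cong vtx e))) , (λ e → inj₂ (inj₂ (cong vtx e))) ]′ ]′
      (around-passage π m)

    off-passage : ∀ π {u} → In3 (l1 π) (l2 π) (l3 π) u → OnF u
    off-passage π (inj₁ e) = before π , sym e
    off-passage π (inj₂ (inj₁ e)) = apex π , sym e
    off-passage π (inj₂ (inj₂ e)) = after π , sym e

    passage-through : ∀ {u v} → OnF u → OnF v → u ≢ v → Σ Passage λ π → l1 π ≡ u × l2 π ≡ v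
    passage-through (m₁ , e₁) (m₂ , e₂) u≢v with around m₂ m₁
    ... | inj₁ refl = (m₂ , true) , e₁ , e₂
    ... | inj₂ (inj₁ refl) = ⊥-elim (u≢v (trans (sym e₁) e₂))
    ... | inj₂ (inj₂ refl) = (m₂ , false) , e₁ , e₂

    Hit : Zigzag T → ℤ → Set
    Hit W t = Σ Passage (AtP W t)

    hit? : ∀ W t → Dec (Hit W t)
    hit? W t with any? (λ π → (seq W t Fin.≟ l1 π) ×-dec (seq W (ℤ.suc t) Fin.≟ l2 π) ×-dec
                               (seq W (ℤ.suc (ℤ.suc t)) Fin.≟ l3 π)) all-passages
    ... | yes found = yes (satisfied found)
    ... | no none = no λ { (π , h) → none (lose (listed π) h) }

    NoHitBetween : Zigzag T → ℤ → ℕ → Set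
    NoHitBetween W t L = ∀ k → 1 ℕ.≤ k → k ℕ.< L → ¬ Hit W (t ℤ.+ + k)

    edge-hit : ∀ W q → OnF (seq W (ℤ.suc q)) → OnF (seq W (ℤ.suc (ℤ.suc q))) → Hit W q ⊎ Hit W (ℤ.suc q)
    edge-hit W q u v with passage-through u v (proj₁ (proj₂ (face-distinct _ _ _ (inFace W q))))
    ... | π , e₁ , e₂ with edge-two-faces (l1 π) (l2 π) (l3 π) (passage-face π)
    ... | _ , _ , _ , only
      with only (seq W (ℤ.suc (ℤ.suc (ℤ.suc q)))) (subst₂ (λ p r → Face p r _) (sym e₁) (sym e₂) (inFace W (ℤ.suc q)))
         | only (seq W q) (subst₂ (λ p r → Face p r _) (sym e₁) (sym e₂) (rotate (inFace W q)))
    ... | inj₁ ahead-in-F | _ = inj₂ (π , sym e₁ , sym e₂ , ahead-in-F)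
    ... | inj₂ _ | inj₁ behind-in-F =
      inj₁ (retreat π , trans behind-in-F (cong vtx (sym (proj₁ (retreat-corner π)))) , sym e₁ ,
            trans (sym e₂) (cong vtx (sym (proj₂ (retreat-corner π)))))
    ... | inj₂ ahead-out | inj₂ behind-out = ⊥-elim (turn W q (trans ahead-out (sym behind-out)))

    no-consecutive-hits : ∀ W i π → AtP W i π → ¬ Hit W (ℤ.suc i)
    no-consecutive-hits W i π (e₀ , e₁ , e₂) (π′ , f₀ , f₁ , f₂) =
      turn W i (trans f₂ (trans (cong l3 next≡) (trans (cong vtx (proj₂ (advance-corner π))) (sym e₀))))
      where
      next≡ : π′ ≡ advance π
      next≡ = passage-injective π′ (advance π)
                (trans (sym f₀) (trans e₁ (cong vtx (sym (proj₁ (advance-corner π)))))) (trans (sym f₁) e₂)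

    monodromy-from-hits : ∀ W i π π′ m → AtP W i π → AtP W (i ℤ.+ + suc (suc m)) π′ →
                          NoHitBetween W i (suc (suc m)) → Mo π π′
    monodromy-from-hits W i π π′ m (e₀ , e₁ , e₂) (f₀ , f₁ , f₂) clear =
      W , i , e₀ , trans (cong (seq W) (plus-1 i)) e₁ , trans (cong (seq W) (plus-2 i)) e₂ , suc m , s≤s z≤n ,
      cong₂ _,_ (trans (cong (seq W) (ℤP.+-assoc i (+ 1) (+ suc m))) f₀)
                (trans (cong (seq W) (plus-2-plus′ i (+ suc m))) f₁) ,
      (on-passage π (before π′ , refl) , on-passage π (apex π′ , refl) , l1≢l2 π′) ,
      λ k 1≤k k<m (u , v , _) →
        [ (λ h → clear k 1≤k (ℕP.m<n⇒m<1+n k<m) h) ,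
          (λ h → clear (suc k) (s≤s z≤n) (s≤s k<m) (subst (Hit W) (suc-inside i (+ k)) h)) ]′
        (edge-hit W (i ℤ.+ + k) (subst OnF (cong (seq W) (plus-1-plus i (+ k))) (off-passage π u))
                               (subst OnF (cong (seq W) (plus-2-plus i (+ k))) (off-passage π v)))

    hits-of-monodromy : ∀ π {e′} → Monodromy T (l1 π) (l2 π) (l3 π) e′ →
      Σ (Zigzag T) λ W → Σ ℤ λ i → Σ ℤ λ q → Σ Passage λ π′ →
        AtP W i π × AtP W q π′ × (l1 π′ , l2 π′) ≡ e′
    hits-of-monodromy π {e′} (W , i , e₀ , e₁ , e₂ , j , 1≤j , edge , (Ωu , Ωv , _) , between)
      with edge-hit W (i ℤ.+ + j)
             (subst OnF (sym (trans (cong (seq W) (sym (plus-1-plus i (+ j)))) (cong proj₁ edge))) (off-passage π Ωu))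
             (subst OnF (sym (trans (cong (seq W) (sym (plus-2-plus i (+ j)))) (cong proj₂ edge))) (off-passage π Ωv))
    ... | inj₂ (π′ , f₀ , f₁ , f₂) =
      W , i , ℤ.suc (i ℤ.+ + j) , π′ , start , (f₀ , f₁ , f₂) ,
      cong₂ _,_ (trans (sym f₀) (trans (cong (seq W) (sym (plus-1-plus i (+ j)))) (cong proj₁ edge)))
                (trans (sym f₁) (trans (cong (seq W) (sym (plus-2-plus i (+ j)))) (cong proj₂ edge)))
      where
      start : AtP W i π
      start = e₀ , trans (cong (seq W) (sym (plus-1 i))) e₁ , trans (cong (seq W) (sym (plus-2 i))) e₂
    ... | inj₁ earlier = ⊥-elim (no-earlier-hit j 1≤j between earlier)
      where
      -- a hit at time i + j would put an edge of F at position j - 1 of the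
      -- search, or (for j = 1) follow the passage at time i immediately
      no-earlier-hit : ∀ j → 1 ℕ.≤ j →
        (∀ k → 1 ℕ.≤ k → k ℕ.< j → ¬ InΩ T (l1 π) (l2 π) (l3 π)
           (seq W (i ℤ.+ + 1 ℤ.+ + k) , seq W (i ℤ.+ + 2 ℤ.+ + k))) →
        ¬ Hit W (i ℤ.+ + j)
      no-earlier-hit (suc zero) _ _ h =
        no-consecutive-hits W i π
          (e₀ , trans (cong (seq W) (sym (plus-1 i))) e₁ , trans (cong (seq W) (sym (plus-2 i))) e₂)
          (subst (Hit W) (plus-1 i) h)
      no-earlier-hit (suc (suc j′)) _ between (π″ , f₀ , f₁ , _) =
        between (suc j′) (s≤s z≤n) (ℕP.n<1+n (suc j′))
          (on-passage π (before π″ , sym (trans (cong (seq W) (ℤP.+-assoc i (+ 1) (+ suc j′))) f₀)) ,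
           on-passage π (apex π″ , sym (trans (cong (seq W) (plus-2-plus′ i (+ suc j′))) f₁)) ,
           λ e → l1≢l2 π″ (trans (sym (trans (cong (seq W) (ℤP.+-assoc i (+ 1) (+ suc j′))) f₀))
                               (trans e (trans (cong (seq W) (plus-2-plus′ i (+ suc j′))) f₁))))

  continues : ∀ W i {a b c d} → At W i c a b → Face a b c → Face a b d → d ≢ c → At W (ℤ.suc i) a b d
  continues W i (e₀ , e₁ , e₂) fabc fabd d≢c =
    e₁ , e₂ , other-face-unique fabc (subst₂ (λ p q → Face p q _) e₁ e₂ (inFace W (ℤ.suc i))) fabd
                (λ e → turn W i (trans e (sym e₀))) d≢c

  module Converse (Z₀ : Zigzag T) where
    Good : V → V → V → Set
    Good x y z = Traverses Z₀ x y z ⊎ Traverses (reverse Z₀) x y z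

    -- goodness is a property of the whole zigzag through a corner
    good-transfer : ∀ W i q {x y z u v w} → At W i x y z → At W q u v w → Good x y z → Good u v w
    good-transfer W i q h h′ (inj₁ (k , h₀)) = inj₁ (q ℤ.- i ℤ.+ k , transfer W Z₀ i k q h h₀ h′)
    good-transfer W i q h h′ (inj₂ (k , h₀)) = inj₂ (q ℤ.- i ℤ.+ k , transfer W (reverse Z₀) i k q h h₀ h′)

    good-mirror : ∀ {x y z} → Good x y z → Good z y x
    good-mirror (inj₁ (k , h)) = inj₂ (ℤ.- ℤ.suc (ℤ.suc k) , reverse-at Z₀ k h)
    good-mirror (inj₂ (k , h)) = inj₁ (ℤ.- ℤ.suc (ℤ.suc k) , reverse-at⁻ Z₀ k h)

    All6 : V → V → V → Set
    All6 a b c = Good a b c × Good b c a × Good c a b × Good a c b × Good c b a × Good b a c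

    rotate6 : ∀ {a b c} → All6 a b c → All6 b c a
    rotate6 (g₁ , g₂ , g₃ , g₄ , g₅ , g₆) = g₂ , g₃ , g₁ , g₆ , g₄ , g₅

    swap6 : ∀ {a b c} → All6 a b c → All6 a c b
    swap6 (g₁ , g₂ , g₃ , g₄ , g₅ , g₆) = g₄ , g₅ , g₆ , g₁ , g₂ , g₃

    module Local (x y z : V) where
      open FaceCorners x y z

      GoodP : Passage → Set
      GoodP π = Good (l1 π) (l2 π) (l3 π)

      good-flip : ∀ π → GoodP π → GoodP (flip π)
      good-flip (m , true) = good-mirror
      good-flip (m , false) = good-mirror

      good-reorient : ∀ π o → GoodP π → GoodP (apex π , o)
      good-reorient (m , true) true g = g
      good-reorient (m , true) false g = good-flip (m , true) g
      good-reorient (m , false) true g = good-flip (m , false) g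
      good-reorient (m , false) false g = g

      Circulation : Bool → Bool → Bool → Set
      Circulation oA oB oC = (GoodP (A , oA) → GoodP (B , oB)) × (GoodP (B , oB) → GoodP (C , oC)) ×
                             (GoodP (C , oC) → GoodP (A , oA))

      Circulates : Set
      Circulates = Σ Bool λ oA → Σ Bool λ oB → Σ Bool λ oC → Circulation oA oB oC

      circulation-all : Circulates → ∀ π → GoodP π → ∀ π′ → GoodP π′
      circulation-all (oA , oB , oC , ab , bc , ca) π g π′ =
        good-reorient (apex π′ , orient (apex π′)) (proj₂ π′)
          (reach (apex π) (apex π′) (good-reorient π (orient (apex π)) g))
        where
        orient : Apex → Bool
        orient A = oA
        orient B = oB
        orient C = oC
        reach : ∀ m m′ → GoodP (m , orient m) → GoodP (m′ , orient m′)
        reach A A g = g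
        reach A B g = ab g
        reach A C g = bc (ab g)
        reach B A g = ca (bc g)
        reach B B g = g
        reach B C g = bc g
        reach C A g = ca g
        reach C B g = ab (ca g)
        reach C C g = g

      all-six : (∀ π → GoodP π) → All6 x y z
      all-six g = g (B , true) , g (C , true) , g (A , true) , g (C , false) , g (B , false) , g (A , false)

      link : Face x y z → ∀ π π′ → Mo π π′ → GoodP π → GoodP π′
      link f π π′ mo g with OnFace.hits-of-monodromy x y z f π mo
      ... | W , i , q , π″ , h , h′ , e with OnFace.passage-injective x y z f π″ π′ (cong proj₁ e) (cong proj₂ e)
      ... | refl = good-transfer W i q h h′ g

    -- Each admissible monodromy contains a circulation (three of its six values suffice).
    circulation-M1 : ∀ {x y z} → Face x y z → M1 T x y z → Local.Circulates x y z
    circulation-M1 {x} {y} {z} f (m₀ ∷ m₁ ∷ m₂ ∷ _) =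
      true , true , true , link f (A , true) (B , true) m₀ , link f (B , true) (C , true) m₁ ,
      link f (C , true) (A , true) m₂
      where open Local x y z

    circulation-M2 : ∀ {x y z} → Face x y z → M2 T x y z → Local.Circulates x y z
    circulation-M2 {x} {y} {z} f (_ ∷ _ ∷ _ ∷ m₃ ∷ m₄ ∷ m₅ ∷ []) =
      false , false , false , link f (A , false) (B , false) m₃ , link f (B , false) (C , false) m₅ ,
      link f (C , false) (A , false) m₄
      where open Local x y z

    circulation-M3 : ∀ {x y z} → Face x y z → M3 T x y z → Local.Circulates x y z
    circulation-M3 {x} {y} {z} f (m₀ ∷ _ ∷ m₂ ∷ m₃ ∷ _) =
      false , false , true , link f (A , false) (B , false) m₃ , link f (B , false) (C , true) m₀ ,
      link f (C , true) (A , false) m₂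
      where open Local x y z

    circulation-M4 : ∀ {x y z} → Face x y z → M4 T x y z → Local.Circulates x y z
    circulation-M4 {x} {y} {z} f (m₀ ∷ _ ∷ _ ∷ m₃ ∷ m₄ ∷ _) =
      true , false , true , link f (A , true) (B , false) m₀ , link f (B , false) (C , true) m₃ ,
      link f (C , true) (A , true) m₄
      where open Local x y z

    spread-from : ∀ {x y z} → Local.Circulates x y z → ∀ π → Local.GoodP x y z π → All6 x y z
    spread-from {x} {y} {z} circ π g = Local.all-six x y z (Local.circulation-all x y z circ π g)

    -- a circulation for some ordering of the face {a, b, c} spreads the
    -- goodness of the corner abc, which is a passage for every ordering
    via-ordering : ∀ {Q : V × V × V → Set} →
      (∀ {x y z} → Face x y z → Q (x , y , z) → Local.Circulates x y z) →
      ∀ {a b c} → Face a b c → Any Q (orderings T a b c) → Good a b c → All6 a b c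
    via-ordering circ f (here q) g = spread-from (circ f q) (B , true) g
    via-ordering circ f (there (here q)) g =
      rotate6 (rotate6 (spread-from (circ (rotate f) q) (A , true) g))
    via-ordering circ f (there (there (here q))) g =
      rotate6 (spread-from (circ (rotate (rotate f)) q) (C , true) g)
    via-ordering circ f (there (there (there (here q)))) g =
      swap6 (spread-from (circ (rotate (rotate (mirror f))) q) (C , false) g)
    via-ordering circ f (there (there (there (there (here q))))) g =
      rotate6 (swap6 (spread-from (circ (mirror f) q) (B , false) g))
    via-ordering circ f (there (there (there (there (there (here q)))))) g =
      swap6 (rotate6 (spread-from (circ (swap f) q) (A , false) g))

    spread : ∀ {a b c} → Face a b c → AdmissibleMonodromy T a b c → Good a b c → All6 a b c
    spread f (inj₁ m) = spread-from (circulation-M1 f m) (B , true)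
    spread f (inj₂ (inj₁ m)) = spread-from (circulation-M2 f m) (B , true)
    spread f (inj₂ (inj₂ (inj₁ k))) = via-ordering circulation-M3 f k
    spread f (inj₂ (inj₂ (inj₂ k))) = via-ordering circulation-M4 f k

    cross-edge : ∀ {a b c d} → Face a b c → Face a b d → d ≢ c → Good c a b → Good a b d
    cross-edge fabc fabd d≢c (inj₁ (i , h)) = inj₁ (ℤ.suc i , continues Z₀ i h fabc fabd d≢c)
    cross-edge fabc fabd d≢c (inj₂ (i , h)) = inj₂ (ℤ.suc i , continues (reverse Z₀) i h fabc fabd d≢c)

    module Propagation (admissible : ∀ a b c → Face a b c → AdmissibleMonodromy T a b c) where
      adjacent : ∀ {a b c d} → Face a b c → All6 a b c → Face a b d → All6 a b d
      adjacent {a} {b} {c} {d} fabc g fabd with d Fin.≟ c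
      ... | yes refl = g
      ... | no d≢c = spread fabd (admissible a b d fabd) (cross-edge fabc fabd d≢c (proj₁ (proj₂ (proj₂ g))))

      GoodStar : V → Set
      GoodStar v = ∀ y z → Face v y z → All6 v y z

      around-link : ∀ v {y y′} → Star (λ p q → Face v p q) y y′ →
                    (Σ V λ z → Face v y z × All6 v y z) → Σ V λ z → Face v y′ z × All6 v y′ z
      around-link v ε found = found
      around-link v {y} (_◅_ {j = y′} fvyy′ rest) (z , fvyz , g) =
        around-link v rest (y , rotate (rotate (mirror fvyy′)) , swap6 (adjacent fvyz g fvyy′))

      at-vertex : ∀ v y z → Face v y z → All6 v y z → GoodStar v
      at-vertex v y z f g y′ z′ f′ with around-link v (link-connected v y z y′ z′ f f′) (z , f , g)
      ... | _ , f″ , g″ = adjacent f″ g″ f′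

      along-path : ∀ {x v} → Star (λ p q → ∃ λ r → Face p q r) x v → GoodStar x → GoodStar v
      along-path ε h = h
      along-path {x} (_◅_ {j = y} (z , f) rest) h =
        along-path rest (at-vertex y z x (rotate f) (rotate6 (h y z f)))

  knotted-if-admissible : (∀ a b c → Face a b c → AdmissibleMonodromy T a b c) → ZKnotted T
  knotted-if-admissible admissible = Z₀ , classify
    where
    x₀ y₀ z₀ : V
    x₀ = proj₁ some-face
    y₀ = proj₁ (proj₂ some-face)
    z₀ = proj₁ (proj₂ (proj₂ some-face))
    f₀ : Face x₀ y₀ z₀
    f₀ = proj₂ (proj₂ (proj₂ some-face))
    Z₀ : Zigzag T
    Z₀ = zigzag-through ((x₀ , y₀ , z₀) , f₀)
    open Converse Z₀
    open Propagation admissible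
    star₀ : GoodStar x₀
    star₀ = at-vertex x₀ y₀ z₀ f₀ (spread f₀ (admissible x₀ y₀ z₀ f₀) (inj₁ (0ℤ , zigzag-through-at f₀)))
    negate : ∀ i k → ℤ.- (i ℤ.+ k) ≡ ℤ.- k ℤ.- i
    negate = solve-∀
    -- every zigzag passes a good corner at time 0, hence is Z₀ or its reverse
    classify : ∀ Z → SameZigzag T Z₀ Z ⊎ ReverseZigzag T Z₀ Z
    classify Z with proj₁ (along-path (connected x₀ (seq Z 0ℤ)) star₀ (seq Z 1ℤ) (seq Z (+ 2)) (inFace Z 0ℤ))
    ... | inj₁ (k , h) = inj₁ (k , λ i → trans (cong (seq Z) (sym (ℤP.+-identityʳ i)))
                                             (agree-at Z Z₀ 0ℤ k (refl , refl , refl) h i))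
    ... | inj₂ (k , h) = inj₂ (ℤ.- k , λ i → trans (cong (seq Z) (sym (ℤP.+-identityʳ i)))
           (trans (agree-at Z (reverse Z₀) 0ℤ k (refl , refl , refl) h i) (cong (seq Z₀) (negate i k))))

  module Knotted (Z : Zigzag T) (unique : ∀ Z′ → SameZigzag T Z Z′ ⊎ ReverseZigzag T Z Z′) where
    traversed : ∀ {x y z} → Face x y z → Traverses Z x y z ⊎ Traverses Z z y x
    traversed {x} {y} {z} f with unique (zigzag-through ((x , y , z) , f))
    ... | inj₁ (k , h) =
      inj₁ (k , trans (cong (seq Z) (sym (ℤP.+-identityˡ k))) (sym (h 0ℤ)) , sym (h 1ℤ) ,
                trans (cong (seq Z) (sym (ℤP.+-assoc 1ℤ 1ℤ k))) (sym (h (+ 2))))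
    ... | inj₂ (k , h) =
      inj₂ (k ℤ.- + 2 , sym (h (+ 2)) , trans (cong (seq Z) (back₁ k)) (sym (h 1ℤ)) ,
                        trans (cong (seq Z) (back₀ k)) (sym (h 0ℤ)))
      where
      back₁ : ∀ k → 1ℤ ℤ.+ (k ℤ.- + 2) ≡ k ℤ.- + 1
      back₁ = solve-∀
      back₀ : ∀ k → 1ℤ ℤ.+ (1ℤ ℤ.+ (k ℤ.- + 2)) ≡ k ℤ.- 0ℤ
      back₀ = solve-∀

    Periodic : ℕ → Set
    Periodic p = ∀ s → seq Z (s ℤ.+ + p) ≡ seq Z s

    repeat-period : ∀ t L {x y z} → At Z t x y z → At Z (t ℤ.+ + L) x y z → Periodic L
    repeat-period t L h h′ s =
      sym (trans (cong (seq Z) (sym (minus-plus s t)))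
                 (trans (agree-at Z Z t (t ℤ.+ + L) h h′ (s ℤ.- t)) (cong (seq Z) (regroup s t (+ L)))))
      where
      regroup : ∀ s t p → (s ℤ.- t) ℤ.+ (t ℤ.+ p) ≡ s ℤ.+ p
      regroup = solve-∀

    -- Z is periodic: two of its first n³ + 1 corners coincide (pigeonhole)
    period : Σ ℕ λ p → 1 ℕ.≤ p × Periodic p
    period with FinP.pigeonhole (ℕP.n<1+n (n ℕ.* (n ℕ.* n))) (λ k → code (+ Fin.toℕ k))
      where
      code : ℤ → Fin (n ℕ.* (n ℕ.* n))
      code t = Fin.combine (seq Z t) (Fin.combine (seq Z (ℤ.suc t)) (seq Z (ℤ.suc (ℤ.suc t))))
    ... | i , j , i<j , same with FinP.combine-injective _ _ _ _ same
    ... | e₀ , e₁₂ with FinP.combine-injective _ _ _ _ e₁₂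
    ... | e₁ , e₂ =
      Fin.toℕ j ℕ.∸ Fin.toℕ i , ℕP.m<n⇒0<n∸m i<j ,
      repeat-period (+ Fin.toℕ i) _ (refl , refl , refl)
        (subst (λ m → At Z (+ m) _ _ _) (sym (ℕP.m+[n∸m]≡n (ℕP.<⇒≤ i<j))) (sym e₀ , sym e₁ , sym e₂))

    -- a fixed period of Z, bounding the search for the next hit
    P₀ : ℕ
    P₀ = proj₁ period

    shift-at : ∀ {p} → Periodic p → ∀ t {x y z} → At Z t x y z → At Z (t ℤ.+ + p) x y z
    shift-at {p} per t (e₀ , e₁ , e₂) =
      trans (per t) e₀ ,
      trans (cong (seq Z) (sym (ℤP.+-assoc 1ℤ t (+ p)))) (trans (per (ℤ.suc t)) e₁) ,
      trans (cong (seq Z) (sym (trans (ℤP.+-assoc 1ℤ (ℤ.suc t) (+ p)) (cong ℤ.suc (ℤP.+-assoc 1ℤ t (+ p))))))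
            (trans (per (ℤ.suc (ℤ.suc t))) e₂)

    periodic-multiple : ∀ {p} → Periodic p → ∀ q s → seq Z (s ℤ.+ q ℤ.* + p) ≡ seq Z s
    periodic-multiple {p} per (+ k) s =
      trans (cong (λ x → seq Z (s ℤ.+ x)) (sym (ℤP.pos-* k p))) (multiple k s)
      where
      regroup : ∀ s P K → s ℤ.+ (P ℤ.+ K) ≡ (s ℤ.+ K) ℤ.+ P
      regroup = solve-∀
      multiple : ∀ k s → seq Z (s ℤ.+ + (k ℕ.* p)) ≡ seq Z s
      multiple zero s = cong (seq Z) (ℤP.+-identityʳ s)
      multiple (suc k) s = trans (cong (seq Z) (regroup s (+ p) (+ (k ℕ.* p))))
                                 (trans (per (s ℤ.+ + (k ℕ.* p))) (multiple k s))
    periodic-multiple {p} per -[1+ k ] s =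
      trans (cong (λ x → seq Z (s ℤ.+ x))
                  (trans (sym (ℤP.neg-distribˡ-* (+ suc k) (+ p))) (cong ℤ.-_ (sym (ℤP.pos-* (suc k) p)))))
            (trans (sym (periodic-multiple per (+ suc k) (s ℤ.- + (suc k ℕ.* p))))
                   (cong (seq Z) (trans (cong (λ x → (s ℤ.- + (suc k ℕ.* p)) ℤ.+ x) (sym (ℤP.pos-* (suc k) p)))
                                        (minus-plus s (+ (suc k ℕ.* p))))))

    unshift-at : ∀ {p} → Periodic p → ∀ q u {x y z} → At Z (u ℤ.+ q ℤ.* + p) x y z → At Z u x y z
    unshift-at per q u (e₀ , e₁ , e₂) =
      trans (sym (periodic-multiple per q u)) e₀ ,
      trans (sym (periodic-multiple per q (ℤ.suc u))) (trans (cong (seq Z) (ℤP.+-assoc 1ℤ u _)) e₁) ,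
      trans (sym (periodic-multiple per q (ℤ.suc (ℤ.suc u))))
            (trans (cong (seq Z) (trans (ℤP.+-assoc 1ℤ (ℤ.suc u) _) (cong ℤ.suc (ℤP.+-assoc 1ℤ u _)))) e₂)

    reduce : ∀ L → Periodic (suc L) → ∀ t h {x y z} → At Z h x y z →
             Σ ℕ λ r → r ℕ.< suc L × At Z (t ℤ.+ + r) x y z
    reduce L per t h at =
      r , ℤDM.n%ℕd<d (h ℤ.- t) (suc L) , unshift-at per q (t ℤ.+ + r) (subst (λ u → At Z u _ _ _) split at)
      where
      r : ℕ
      r = (h ℤ.- t) ℤ.%ℕ suc L
      q : ℤ
      q = (h ℤ.- t) ℤ./ℕ suc L
      regroup : ∀ t r x → (r ℤ.+ x) ℤ.+ t ≡ (t ℤ.+ r) ℤ.+ x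
      regroup = solve-∀
      split : h ≡ (t ℤ.+ + r) ℤ.+ q ℤ.* + suc L
      split = trans (sym (minus-plus h t))
                (trans (cong (ℤ._+ t) (ℤDM.a≡a%ℕn+[a/ℕn]*n (h ℤ.- t) (suc L))) (regroup t (+ r) (q ℤ.* + suc L)))

    window : ∀ t L {x y z} → At Z t x y z → At Z (t ℤ.+ + suc L) x y z →
             ∀ h {u v w} → At Z h u v w → Σ ℕ λ r → r ℕ.< suc L × At Z (t ℤ.+ + r) u v w
    window t L at at′ = reduce L (repeat-period t (suc L) at at′) t

    module AtFace (a b c : V) (fabc : Face a b c) where
      open FaceCorners a b c
      open OnFace a b c fabc

      passage-with-apex : ∀ m → Σ Passage λ π → apex π ≡ m × Σ ℤ λ t → AtP Z t π
      passage-with-apex m with traversed (passage-face (m , true))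
      ... | inj₁ (t , h) = (m , true) , refl , t , h
      ... | inj₂ (t , h) = (m , false) , refl , t , h

      one-way : ∀ {i k} π → AtP Z i π → AtP Z k (flip π) → ⊥
      one-way {i} {k} π h h′ = not-both-directions Z i k h (mirror-at⁻ Z k π h′)

      record Step (t : ℤ) (π : Passage) : Set where
        constructor step
        field
          departs : AtP Z t π
          gap : ℕ
          target : Passage
          arrives : AtP Z (t ℤ.+ + suc (suc gap)) target
          clear : NoHitBetween Z t (suc (suc gap))
      open Step

      arrival : ∀ {t π} → Step t π → ℤ
      arrival {t} s = t ℤ.+ + suc (suc (gap s))

      -- every hit has a next one: the same passage recurs a period later
      next-hit : ∀ {t π} → AtP Z t π → Step t π
      next-hit {t} {π} h =
        from-least (least P₀ (proj₁ (proj₂ period) , π , shift-at (proj₂ (proj₂ period)) t h))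
        where
        open LeastWitness (λ k → (1 ℕ.≤? k) ×-dec hit? Z (t ℤ.+ + k))
        from-least : Σ ℕ Least → Step t π
        from-least (zero , (() , _) , _)
        from-least (suc zero , (_ , hit) , _) =
          ⊥-elim (no-consecutive-hits Z t π h (subst (Hit Z) (plus-1 t) hit))
        from-least (suc (suc m) , (_ , (π′ , h′)) , earlier) =
          step h m π′ h′ (λ k 1≤k k<m hit → earlier k k<m (1≤k , hit))

      sole-passage : ∀ t L π → AtP Z t π → AtP Z (t ℤ.+ + suc L) π → NoHitBetween Z t (suc L) →
                     ∀ {h} π′ → AtP Z h π′ → π′ ≡ π
      sole-passage t L π h h′ clear π′ h″ with window t L h h′ _ h″
      ... | zero , _ , at = same-time Z t π′ π (subst (λ u → AtP Z u π′) (ℤP.+-identityʳ t) at) h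
      ... | suc r , r<L , at = ⊥-elim (clear (suc r) (s≤s z≤n) r<L (π′ , at))

      two-passages : ∀ t L₁ L₂ π π₁ → AtP Z t π → AtP Z (t ℤ.+ + suc L₁) π₁ →
        AtP Z ((t ℤ.+ + suc L₁) ℤ.+ + suc L₂) π → NoHitBetween Z t (suc L₁) →
        NoHitBetween Z (t ℤ.+ + suc L₁) (suc L₂) → ∀ {h} π′ → AtP Z h π′ → π′ ≡ π ⊎ π′ ≡ π₁
      two-passages t L₁ L₂ π π₁ h h₁ h₂ clear₁ clear₂ π′ h′
        with window t (L₁ ℕ.+ suc L₂) h (subst (λ u → AtP Z u π) (ℤP.+-assoc t (+ suc L₁) (+ suc L₂)) h₂) _ h′
      ... | r , r< , at with ℕP.<-cmp r (suc L₁)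
      ...   | tri< r<L₁ _ _ = inj₁ (first-stretch r r<L₁ at)
        where
        first-stretch : ∀ r → r ℕ.< suc L₁ → AtP Z (t ℤ.+ + r) π′ → π′ ≡ π
        first-stretch zero _ at = same-time Z t π′ π (subst (λ u → AtP Z u π′) (ℤP.+-identityʳ t) at) h
        first-stretch (suc r) r<L₁ at = ⊥-elim (clear₁ (suc r) (s≤s z≤n) r<L₁ (π′ , at))
      ...   | tri≈ _ refl _ = inj₂ (same-time Z (t ℤ.+ + suc L₁) π′ π₁ at h₁)
      ...   | tri> _ _ L₁<r = ⊥-elim (clear₂ r′ (ℕP.m<n⇒0<n∸m L₁<r) r′< (π′ , subst (λ u → AtP Z u π′) index at))
        where
        r′ : ℕ
        r′ = r ℕ.∸ suc L₁
        r≡ : suc L₁ ℕ.+ r′ ≡ r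
        r≡ = ℕP.m+[n∸m]≡n (ℕP.<⇒≤ L₁<r)
        r′< : r′ ℕ.< suc L₂
        r′< = ℕP.+-cancelˡ-< (suc L₁) r′ (suc L₂) (subst (ℕ._< suc L₁ ℕ.+ suc L₂) (sym r≡) r<)
        index : t ℤ.+ + r ≡ (t ℤ.+ + suc L₁) ℤ.+ + r′
        index = trans (cong (λ x → t ℤ.+ + x) (sym r≡)) (sym (ℤP.+-assoc t (+ suc L₁) (+ r′)))

      apex-changes : ∀ {t π} (s : Step t π) → apex (target s) ≢ apex π
      apex-changes {t} {π} (step h g π′ h′ clear) same with same-apex π π′ same
      ... | inj₂ refl = one-way π h h′
      ... | inj₁ refl with passage-with-apex (succ (apex π))
      ...   | π″ , at-succ , _ , h″ =
        succ≢self (apex π) (trans (sym at-succ) (cong apex (sole-passage t (suc g) π h h′ clear π″ h″)))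

      apex-changes² : ∀ {t π} (s₁ : Step t π) (s₂ : Step (arrival s₁) (target s₁)) →
                      apex (target s₁) ≢ apex π → apex (target s₂) ≢ apex π
      apex-changes² {t} {π} (step h g₁ π₁ h₁ clear₁) (step _ g₂ π₂ h₂ clear₂) d same with same-apex π π₂ same
      ... | inj₂ refl = one-way π h h₂
      ... | inj₁ refl with third-apex (apex π) (apex π₁) d
      ...   | m , m≢ , m≢₁ with passage-with-apex m
      ...     | π′ , refl , _ , h′ =
        [ (λ e → m≢ (cong apex e)) , (λ e → m≢₁ (cong apex e)) ]′
          (two-passages t (suc g₁) (suc g₂) π π₁ h h₁ h₂ clear₁ clear₂ π′ h′)

      returns : ∀ {t o} (s₁ : Step t (A , o)) (s₂ : Step (arrival s₁) (target s₁))
                (s₃ : Step (arrival s₂) (target s₂)) → target s₃ ≡ (A , o)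
      returns {o = o} s₁ s₂ s₃ =
        [ (λ back → back) ,
          (λ flipped → ⊥-elim (one-way (A , o) (departs s₁) (subst (AtP Z _) flipped (arrives s₃)))) ]′
        (same-apex (A , o) (target s₃)
          (returns-to-A _ _ _ (apex-changes s₁) (apex-changes s₂) (apex-changes² s₁ s₂ (apex-changes s₁))
                              (apex-changes s₃) (apex-changes² s₂ s₃ (apex-changes s₂))))

      -- a step computes M_F on its first passage ...
      forward : ∀ {t π} (s : Step t π) → Mo π (target s)
      forward {t} {π} (step h g π′ h′ clear) = monodromy-from-hits Z t π π′ g h h′ clear

      mirror-time : ℤ → ℤ
      mirror-time t = ℤ.- ℤ.suc (ℤ.suc t)

      reverse-clear : ∀ t L → NoHitBetween Z t L → NoHitBetween (reverse Z) (mirror-time (t ℤ.+ + L)) L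
      reverse-clear t L clear zero ()
      reverse-clear t L clear (suc k) _ k<L (π , h) =
        clear k′ (ℕP.m<n⇒0<n∸m k<L) k′<
          (flip π , subst (λ u → AtP Z u (flip π)) index (mirror-at Z _ π (reverse-at⁻ Z _ h)))
        where
        k′ : ℕ
        k′ = L ℕ.∸ suc k
        k≡ : suc k ℕ.+ k′ ≡ L
        k≡ = ℕP.m+[n∸m]≡n (ℕP.<⇒≤ k<L)
        k′< : k′ ℕ.< L
        k′< = subst (k′ ℕ.<_) k≡ (s≤s (ℕP.m≤n+m k′ k))
        reflect : ∀ t k k′ → ℤ.- (1ℤ ℤ.+ (1ℤ ℤ.+ ((ℤ.- (1ℤ ℤ.+ (1ℤ ℤ.+ (t ℤ.+ (k ℤ.+ k′))))) ℤ.+ k))) ≡ t ℤ.+ k′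
        reflect = solve-∀
        index : mirror-time (mirror-time (t ℤ.+ + L) ℤ.+ + suc k) ≡ t ℤ.+ + k′
        index = trans (cong (λ x → mirror-time (mirror-time (t ℤ.+ + x) ℤ.+ + suc k)) (sym k≡))
                      (reflect t (+ suc k) (+ k′))

      -- ... and, run backwards by the reverse zigzag, on the flipped passages
      backward : ∀ {t π} (s : Step t π) → Mo (flip (target s)) (flip π)
      backward {t} {π} (step h g π′ h′ clear) =
        monodromy-from-hits (reverse Z) (mirror-time (t ℤ.+ + suc (suc g))) (flip π′) (flip π) g
          (mirror-at (reverse Z) _ π′ (reverse-at Z _ h′))
          (subst (λ u → AtP (reverse Z) u (flip π)) (realign t (+ suc (suc g))) (mirror-at (reverse Z) _ π (reverse-at Z t h)))
          (reverse-clear t (suc (suc g)) clear)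
        where
        realign : ∀ t L → ℤ.- (1ℤ ℤ.+ (1ℤ ℤ.+ t)) ≡ ℤ.- (1ℤ ℤ.+ (1ℤ ℤ.+ (t ℤ.+ L))) ℤ.+ L
        realign = solve-∀

      -- Given the cyclic order A → π₁ → π₂ → A of the passages and their
      -- orientations, the forward values M₀₁, M₁₂, M₂₀ and the values R₀₂,
      -- R₂₁, R₁₀ on the flipped passages form one of the admissible monodromies.
      assemble : ∀ o₀ π₁ π₂ → apex π₁ ≢ A → apex π₂ ≢ apex π₁ → apex π₂ ≢ A →
        Mo (A , o₀) π₁ → Mo π₁ π₂ → Mo π₂ (A , o₀) →
        Mo (flip (A , o₀)) (flip π₂) → Mo (flip π₂) (flip π₁) → Mo (flip π₁) (flip (A , o₀)) →
        AdmissibleMonodromy T a b c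
      assemble _ (A , _) _ d _ _ _ _ _ _ _ _ = ⊥-elim (d refl)
      assemble _ (B , _) (B , _) _ d _ _ _ _ _ _ _ = ⊥-elim (d refl)
      assemble _ (C , _) (C , _) _ d _ _ _ _ _ _ _ = ⊥-elim (d refl)
      assemble _ _ (A , _) _ _ d _ _ _ _ _ _ = ⊥-elim (d refl)
      assemble true (B , true) (C , true) _ _ _ M₀₁ M₁₂ M₂₀ R₀₂ R₂₁ R₁₀ =
        inj₁ (M₀₁ ∷ M₁₂ ∷ M₂₀ ∷ R₀₂ ∷ R₂₁ ∷ R₁₀ ∷ [])
      assemble true (B , true) (C , false) _ _ _ M₀₁ M₁₂ M₂₀ R₀₂ R₂₁ R₁₀ =
        inj₂ (inj₂ (inj₂ (there (here (M₁₂ ∷ R₀₂ ∷ R₂₁ ∷ M₂₀ ∷ M₀₁ ∷ R₁₀ ∷ [])))))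
      assemble true (B , false) (C , true) _ _ _ M₀₁ M₁₂ M₂₀ R₀₂ R₂₁ R₁₀ =
        inj₂ (inj₂ (inj₂ (here (M₀₁ ∷ R₂₁ ∷ R₁₀ ∷ M₁₂ ∷ M₂₀ ∷ R₀₂ ∷ []))))
      assemble true (B , false) (C , false) _ _ _ M₀₁ M₁₂ M₂₀ R₀₂ R₂₁ R₁₀ =
        inj₂ (inj₂ (inj₁ (there (here (M₂₀ ∷ R₂₁ ∷ M₀₁ ∷ M₁₂ ∷ R₀₂ ∷ R₁₀ ∷ [])))))
      assemble false (B , true) (C , true) _ _ _ M₀₁ M₁₂ M₂₀ R₀₂ R₂₁ R₁₀ =
        inj₂ (inj₂ (inj₂ (there (there (here (M₂₀ ∷ R₁₀ ∷ R₀₂ ∷ M₀₁ ∷ M₁₂ ∷ R₂₁ ∷ []))))))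
      assemble false (B , true) (C , false) _ _ _ M₀₁ M₁₂ M₂₀ R₀₂ R₂₁ R₁₀ =
        inj₂ (inj₂ (inj₁ (there (there (here (M₀₁ ∷ R₀₂ ∷ M₁₂ ∷ M₂₀ ∷ R₁₀ ∷ R₂₁ ∷ []))))))
      assemble false (B , false) (C , true) _ _ _ M₀₁ M₁₂ M₂₀ R₀₂ R₂₁ R₁₀ =
        inj₂ (inj₂ (inj₁ (here (M₁₂ ∷ R₁₀ ∷ M₂₀ ∷ M₀₁ ∷ R₂₁ ∷ R₀₂ ∷ []))))
      assemble false (B , false) (C , false) _ _ _ M₀₁ M₁₂ M₂₀ R₀₂ R₂₁ R₁₀ =
        inj₂ (inj₁ (R₀₂ ∷ R₁₀ ∷ R₂₁ ∷ M₀₁ ∷ M₂₀ ∷ M₁₂ ∷ []))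
      assemble true (C , true) (B , true) _ _ _ M₀₁ M₁₂ M₂₀ R₀₂ R₂₁ R₁₀ =
        inj₂ (inj₁ (M₀₁ ∷ M₂₀ ∷ M₁₂ ∷ R₀₂ ∷ R₁₀ ∷ R₂₁ ∷ []))
      assemble true (C , true) (B , false) _ _ _ M₀₁ M₁₂ M₂₀ R₀₂ R₂₁ R₁₀ =
        inj₂ (inj₂ (inj₁ (there (there (here (R₀₂ ∷ M₀₁ ∷ R₂₁ ∷ R₁₀ ∷ M₂₀ ∷ M₁₂ ∷ []))))))
      assemble true (C , false) (B , true) _ _ _ M₀₁ M₁₂ M₂₀ R₀₂ R₂₁ R₁₀ =
        inj₂ (inj₂ (inj₁ (here (R₂₁ ∷ M₂₀ ∷ R₁₀ ∷ R₀₂ ∷ M₁₂ ∷ M₀₁ ∷ []))))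
      assemble true (C , false) (B , false) _ _ _ M₀₁ M₁₂ M₂₀ R₀₂ R₂₁ R₁₀ =
        inj₂ (inj₂ (inj₂ (there (there (here (R₁₀ ∷ M₂₀ ∷ M₀₁ ∷ R₀₂ ∷ R₂₁ ∷ M₁₂ ∷ []))))))
      assemble false (C , true) (B , true) _ _ _ M₀₁ M₁₂ M₂₀ R₀₂ R₂₁ R₁₀ =
        inj₂ (inj₂ (inj₁ (there (here (R₁₀ ∷ M₁₂ ∷ R₀₂ ∷ R₂₁ ∷ M₀₁ ∷ M₂₀ ∷ [])))))
      assemble false (C , true) (B , false) _ _ _ M₀₁ M₁₂ M₂₀ R₀₂ R₂₁ R₁₀ =
        inj₂ (inj₂ (inj₂ (there (here (R₂₁ ∷ M₀₁ ∷ M₁₂ ∷ R₁₀ ∷ R₀₂ ∷ M₂₀ ∷ [])))))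
      assemble false (C , false) (B , true) _ _ _ M₀₁ M₁₂ M₂₀ R₀₂ R₂₁ R₁₀ =
        inj₂ (inj₂ (inj₂ (here (R₀₂ ∷ M₁₂ ∷ M₂₀ ∷ R₂₁ ∷ R₁₀ ∷ M₀₁ ∷ []))))
      assemble false (C , false) (B , false) _ _ _ M₀₁ M₁₂ M₂₀ R₀₂ R₂₁ R₁₀ =
        inj₁ (R₀₂ ∷ R₂₁ ∷ R₁₀ ∷ M₀₁ ∷ M₁₂ ∷ M₂₀ ∷ [])

      circuit : ∀ {t} o₀ (s₁ : Step t (A , o₀)) (s₂ : Step (arrival s₁) (target s₁))
                (s₃ : Step (arrival s₂) (target s₂)) → AdmissibleMonodromy T a b c
      circuit o₀ s₁ s₂ s₃ =
        assemble o₀ (target s₁) (target s₂)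
          (apex-changes s₁) (apex-changes s₂) (apex-changes² s₁ s₂ (apex-changes s₁))
          (forward s₁) (forward s₂) (subst (Mo (target s₂)) back (forward s₃))
          (subst (λ π → Mo (flip π) (flip (target s₂))) back (backward s₃)) (backward s₂) (backward s₁)
        where
        back : target s₃ ≡ (A , o₀)
        back = returns s₁ s₂ s₃

      admissible : AdmissibleMonodromy T a b c
      admissible = from-start (passage-with-apex A)
        where
        from-start : (Σ Passage λ π → apex π ≡ A × Σ ℤ λ t → AtP Z t π) → AdmissibleMonodromy T a b c
        from-start ((.A , o₀) , refl , t₀ , h₀) = circuit o₀ s₁ s₂ (next-hit (arrives s₂))
          where
          s₁ : Step t₀ (A , o₀)
          s₁ = next-hit h₀
          s₂ : Step (arrival s₁) (target s₁)
          s₂ = next-hit (arrives s₁)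

  admissible-if-knotted : ZKnotted T → ∀ a b c → Face a b c → AdmissibleMonodromy T a b c
  admissible-if-knotted (Z , unique) = Knotted.AtFace.admissible Z unique

theorem3 : ∀ {n} (T : Triangulation n) →
    ZKnotted T ⇔
    (∀ a b c → Triangulation.face T a b c ≡ true → AdmissibleMonodromy T a b c)
theorem3 T = mk⇔ admissible-if-knotted knotted-if-admissible
  where open Zigzags T
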